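{- Let $n$ be a positive integer and $k$ an integer with $0\le k\le n$. The number of weak compositions of $n-k$ in which exactly $k$ parts are $0$ (all other parts positive) equals the sum of all principal minors of order $n-k$ of the matrix $F_{n,1}$.
   Context: $F_{n,1}$ is the $n\times n$ matrix with entries $F_{n,1}(i,j)=-1$ if $i=j+1$, $F_{n,1}(i,j)=1$ if $j\geq i$, and $0$ otherwise. The principal minor of order $0$ is $1$. A weak composition is an ordered sequence of nonnegative integers with the given sum. -}

module Defs where

open import Data.Nat as ℕ using (ℕ; zero; suc; _∸_; _≤?_; _≟_)
open import Data.Integer as ℤ using (ℤ; +_; -_; _*_; _+_)
open import Data.Fin using (Fin; zero; suc; toℕ; punchIn)
open import Data.Vec as Vec using (Vec; []; _∷_; lookup)
open import Data.List as List using (List; []; _∷_; _++_; length; filter)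
open import Data.Bool using (if_then_else_)
open import Relation.Nullary.Decidable using (does)
open import Relation.Binary.PropositionalEquality using (_≡_)
open import Data.Product using (Σ; _×_)
open import Data.Nat.ListAction using (sum)

sumFin : (m : ℕ) → (Fin m → ℤ) → ℤ
sumFin zero    f = + 0
sumFin (suc m) f = f zero + sumFin m (λ i → f (suc i))

sign : ℕ → ℤ
sign zero    = + 1
sign (suc i) = - sign i

det : (m : ℕ) → (Fin m → Fin m → ℤ) → ℤ
det zero    M = + 1
det (suc m) M =
  sumFin (suc m) (λ j → sign (toℕ j) * (M zero j * det m (λ a b → M (suc a) (punchIn j b))))

F : (n : ℕ) → Fin n → Fin n → ℤ
F n i j =
  if does (toℕ i ≟ suc (toℕ j)) then - (+ 1)
  else if does (toℕ i ≤? toℕ j) then + 1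
  else + 0

-- All strictly increasing sequences of length m in Fin n (i.e. m-subsets of Fin n)
choose : (n m : ℕ) → List (Vec (Fin n) m)
choose n       zero    = [] ∷ []
choose zero    (suc m) = []
choose (suc n) (suc m) =
  List.map (λ v → zero ∷ Vec.map suc v) (choose n m) ++ List.map (Vec.map suc) (choose n (suc m))

principalMinor : {n m : ℕ} → (Fin n → Fin n → ℤ) → Vec (Fin n) m → ℤ
principalMinor {m = m} M v = det m (λ a b → M (lookup v a) (lookup v b))

sumPrincipalMinors : (n m : ℕ) → (Fin n → Fin n → ℤ) → ℤ
sumPrincipalMinors n m M = List.foldr _+_ (+ 0) (List.map (principalMinor M) (choose n m))

zeroCount : List ℕ → ℕ
zeroCount l = length (filter (_≟ 0) l)

WeakCompZeros : (s k : ℕ) → Set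
WeakCompZeros s k = Σ (List ℕ) (λ l → (sum l ≡ s) × (zeroCount l ≡ k))

module Submission where

-- Let S n m be the sum of the principal minors of order m of
-- F_n, and Z n m the sum of those principal minors of order m+1 of F_{n+1}
-- whose index set contains 0.  Since F is a Toeplitz matrix, dropping
-- index 0 of F_{n+1} gives F_n, and the first column of F is (1,-1,0,...,0).
-- Laplace expansion then gives, splitting index sets by whether they contain
-- 0 (and 1):
--     S (n+1) (m+1) = Z n m + S n (m+1),   Z (n+1) (m+1) = 2 Z n m + S n (m+1).
--
-- Splitting a composition by its first part gives explicit
-- bijections showing that the compositions are counted by a pair of
-- functions A, B obeying the same recurrences (B counts compositions with
-- an extra free leading part).  A double induction identifies
-- S (s+k) s with A s k, which proves the theorem with n = s+k.

open import Defs
open import Data.Nat as ℕ using (ℕ; zero; suc; _∸_; _≤_; _<_; s≤s)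
open import Data.Nat.Properties as ℕP using (≡-irrelevant; suc-injective)
open import Data.Integer using (ℤ; +_; -_; _*_; _+_; _-_)
import Data.Integer.Properties as ℤP
open import Data.Integer.Tactic.RingSolver using (solve-∀)
open import Data.Fin as Fin using (Fin; zero; suc; toℕ; punchIn; punchOut; _≟_)
open import Data.Fin.Properties using (punchIn-punchOut; +↔⊎)
open import Data.Vec as Vec using (Vec; _∷_; lookup)
open import Data.Vec.Properties using (lookup-map)
open import Data.List as List using (List; []; _∷_; _++_)
open import Data.Nat.ListAction using (sum)
open import Data.Product using (Σ; _×_; _,_)
open import Data.Sum using (_⊎_; inj₁; inj₂)
open import Data.Sum.Function.Propositional using (_⊎-↔_)
open import Function.Bundles using (_↔_; mk↔ₛ′)
open import Function.Properties.Inverse using (↔-trans)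
open import Relation.Binary.PropositionalEquality
open import Relation.Nullary using (yes; no)
open import Function.Base using (_⟨_⟩_)

sumFin-cong : ∀ m {f g : Fin m → ℤ} → (∀ j → f j ≡ g j) → sumFin m f ≡ sumFin m g
sumFin-cong zero    f≡g = refl
sumFin-cong (suc m) f≡g = cong₂ _+_ (f≡g zero) (sumFin-cong m (λ j → f≡g (suc j)))

sumFin-zero : ∀ m {f : Fin m → ℤ} → (∀ j → f j ≡ + 0) → sumFin m f ≡ + 0
sumFin-zero m f≡0 = sumFin-cong m f≡0 ⟨ trans ⟩ zeros m
  where
  zeros : ∀ m → sumFin m (λ _ → + 0) ≡ + 0
  zeros zero    = refl
  zeros (suc m) = trans (ℤP.+-identityˡ _) (zeros m)

sumFin-scale : ∀ m c (f : Fin m → ℤ) → sumFin m (λ j → c * f j) ≡ c * sumFin m f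
sumFin-scale zero    c f = sym (ℤP.*-zeroʳ c)
sumFin-scale (suc m) c f = begin
    c * f zero + sumFin m (λ j → c * f (suc j))
  ≡⟨ cong (λ t → c * f zero + t) (sumFin-scale m c (λ j → f (suc j))) ⟩
    c * f zero + c * sumFin m (λ j → f (suc j))
  ≡⟨ ℤP.*-distribˡ-+ c (f zero) _ ⟨
    c * sumFin (suc m) f ∎
  where open ≡-Reasoning

Matrix : ℕ → Set
Matrix m = Fin m → Fin m → ℤ

lowerRight : ∀ {m} → Matrix (suc m) → Matrix m
lowerRight M a b = M (suc a) (suc b)

det-cong : ∀ m {M N : Matrix m} → (∀ a b → M a b ≡ N a b) → det m M ≡ det m N
det-cong zero    M≡N = refl
det-cong (suc m) M≡N = sumFin-cong (suc m) λ j →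
  cong₂ (λ x y → sign (toℕ j) * (x * y))
        (M≡N zero j) (det-cong m (λ a b → M≡N (suc a) (punchIn j b)))

-- A matrix with a zero column has determinant zero: in the expansion, the
-- term of that column has a zero entry, every other minor keeps the column.
det-zero-column : ∀ m (M : Matrix m) (c : Fin m) → (∀ a → M a c ≡ + 0) → det m M ≡ + 0
det-zero-column (suc m) M c col = sumFin-zero (suc m) term
  where
  term : ∀ j → sign (toℕ j) * (M zero j * det m (λ a b → M (suc a) (punchIn j b))) ≡ + 0
  term j with j ≟ c
  ... | yes refl rewrite col zero = ℤP.*-zeroʳ (sign (toℕ j))
  ... | no j≢c
    rewrite det-zero-column m (λ a b → M (suc a) (punchIn j b)) (punchOut j≢c)
              (λ a → cong (M (suc a)) (punchIn-punchOut j≢c) ⟨ trans ⟩ col (suc a))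
          | ℤP.*-zeroʳ (M zero j)
    = ℤP.*-zeroʳ (sign (toℕ j))

-- If the first column vanishes below row 0, every minor obtained by deleting
-- row 0 and a column other than the first has a zero column.
minor-off-first-vanishes : ∀ m (M : Matrix (suc m)) → (∀ a → M (suc a) zero ≡ + 0) →
  ∀ j → det m (λ a b → M (suc a) (punchIn (suc j) b)) ≡ + 0
minor-off-first-vanishes (suc m) M col j =
  det-zero-column (suc m) (λ a b → M (suc a) (punchIn (suc j) b)) zero col

det-first-column : ∀ m (M : Matrix (suc m)) → (∀ a → M (suc a) zero ≡ + 0) →
  det (suc m) M ≡ M zero zero * det m (lowerRight M)
det-first-column m M col = begin
    sign 0 * (M zero zero * det m (lowerRight M)) + sumFin m others
  ≡⟨ cong (λ t → sign 0 * (M zero zero * det m (lowerRight M)) + t) (sumFin-zero m others-vanish) ⟩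
    + 1 * (M zero zero * det m (lowerRight M)) + + 0
  ≡⟨ ℤP.+-identityʳ _ ⟩
    + 1 * (M zero zero * det m (lowerRight M))
  ≡⟨ ℤP.*-identityˡ _ ⟩
    M zero zero * det m (lowerRight M) ∎
  where
  open ≡-Reasoning
  others : Fin m → ℤ
  others j = sign (toℕ (suc j)) * (M zero (suc j) * det m (λ a b → M (suc a) (punchIn (suc j) b)))
  others-vanish : ∀ j → others j ≡ + 0
  others-vanish j rewrite minor-off-first-vanishes m M col j
                        | ℤP.*-zeroʳ (M zero (suc j)) = ℤP.*-zeroʳ (sign (toℕ (suc j)))

-- If the first column vanishes below row 1 and rows 0 and 1 agree outside the
-- first column, then det M = (M₀₀ - M₁₀) · det (lowerRight M): each minor of
-- the expansion along row 0 off the first column is expanded by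
-- det-first-column, and the resulting sum is the expansion of lowerRight M
-- along its first row.
det-two-rows : ∀ m (M : Matrix (suc (suc m))) →
  (∀ b → M zero (suc b) ≡ M (suc zero) (suc b)) → (∀ a → M (suc (suc a)) zero ≡ + 0) →
  det (suc (suc m)) M ≡ (M zero zero - M (suc zero) zero) * det (suc m) (lowerRight M)
det-two-rows m M rows col = begin
    sign 0 * (M zero zero * L) + sumFin (suc m) others
  ≡⟨ cong (λ t → leading + t) (sumFin-cong (suc m) others-expand) ⟩
    sign 0 * (M zero zero * L) + sumFin (suc m) (λ j → (- M (suc zero) zero) * rowTerm j)
  ≡⟨ cong (λ t → leading + t) (sumFin-scale (suc m) (- M (suc zero) zero) rowTerm) ⟩
    sign 0 * (M zero zero * L) + (- M (suc zero) zero) * L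
  ≡⟨ collect (M zero zero) (M (suc zero) zero) L ⟩
    (M zero zero - M (suc zero) zero) * L ∎
  where
  open ≡-Reasoning
  L : ℤ
  L = det (suc m) (lowerRight M)
  leading : ℤ
  leading = sign 0 * (M zero zero * L)
  D : Fin (suc m) → ℤ
  D j = det m (λ a b → M (suc (suc a)) (suc (punchIn j b)))
  rowTerm : Fin (suc m) → ℤ
  rowTerm j = sign (toℕ j) * (M (suc zero) (suc j) * D j)
  others : Fin (suc m) → ℤ
  others j = sign (toℕ (suc j)) * (M zero (suc j) * det (suc m) (λ a b → M (suc a) (punchIn (suc j) b)))
  others-expand : ∀ j → others j ≡ (- M (suc zero) zero) * rowTerm j
  others-expand j
    rewrite rows j | det-first-column m (λ a b → M (suc a) (punchIn (suc j) b)) col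
    = rearrange (sign (toℕ j)) (M (suc zero) zero) (M (suc zero) (suc j)) (D j)
    where
    rearrange : ∀ s x y d → (- s) * (y * (x * d)) ≡ (- x) * (s * (y * d))
    rearrange = solve-∀
  collect : ∀ a c l → + 1 * (a * l) + (- c) * l ≡ (a - c) * l
  collect = solve-∀

F-shift : ∀ n (i j : Fin n) → F (suc n) (suc i) (suc j) ≡ F n i j
F-shift n zero    j = refl
F-shift n (suc i) j = refl

F-rows-agree : ∀ n (j : Fin (suc n)) → F (suc (suc n)) zero (suc j) ≡ F (suc (suc n)) (suc zero) (suc j)
F-rows-agree n zero    = refl
F-rows-agree n (suc j) = refl

F-first-column : ∀ n (i : Fin n) → F (suc (suc n)) (suc (suc i)) zero ≡ + 0
F-first-column n i = refl

restrict : ∀ {n m} → Matrix n → Vec (Fin n) m → Matrix m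
restrict M v a b = M (lookup v a) (lookup v b)

withZero : ∀ {n m} → Vec (Fin n) m → Vec (Fin (suc n)) (suc m)
withZero v = zero ∷ Vec.map suc v

lookup-suc² : ∀ {n m} (u : Vec (Fin n) m) (a : Fin m) →
  lookup (Vec.map Fin.suc (Vec.map Fin.suc u)) a ≡ Fin.suc (Fin.suc (lookup u a))
lookup-suc² u a = lookup-map a suc (Vec.map suc u) ⟨ trans ⟩ cong suc (lookup-map a suc u)

principalMinor-shift : ∀ n m (v : Vec (Fin n) m) →
  principalMinor (F (suc n)) (Vec.map suc v) ≡ principalMinor (F n) v
principalMinor-shift n m v = det-cong m λ a b →
  cong₂ (F (suc n)) (lookup-map a suc v) (lookup-map b suc v) ⟨ trans ⟩ F-shift n (lookup v a) (lookup v b)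

-- For an index set containing 0 but not 1 the first column of the minor is
-- (1,0,...,0), so the minor reduces to the one on the remaining indices.
minor-zero-not-one : ∀ n m (u : Vec (Fin n) m) →
  principalMinor (F (suc (suc n))) (withZero (Vec.map suc u)) ≡ principalMinor (F n) u
minor-zero-not-one n m u = begin
    det (suc m) M
  ≡⟨ det-first-column m M (λ a → cong (λ x → F (suc (suc n)) x zero) (lookup-suc² u a)) ⟩
    + 1 * principalMinor (F (suc (suc n))) (Vec.map suc (Vec.map suc u))
  ≡⟨ ℤP.*-identityˡ _ ⟩
    principalMinor (F (suc (suc n))) (Vec.map suc (Vec.map suc u))
  ≡⟨ principalMinor-shift (suc n) m (Vec.map suc u) ⟩
    principalMinor (F (suc n)) (Vec.map suc u)
  ≡⟨ principalMinor-shift n m u ⟩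
    principalMinor (F n) u ∎
  where
  open ≡-Reasoning
  M : Matrix (suc m)
  M = restrict (F (suc (suc n))) (withZero (Vec.map suc u))

-- For an index set containing 0 and 1 the first column of the minor is
-- (1,-1,0,...,0) and rows 0 and 1 agree elsewhere, so the minor is twice the
-- minor without index 0.
minor-zero-one : ∀ n m (u : Vec (Fin n) m) →
  principalMinor (F (suc (suc n))) (withZero (withZero u))
    ≡ principalMinor (F (suc n)) (withZero u) + principalMinor (F (suc n)) (withZero u)
minor-zero-one n m u = begin
    det (suc (suc m)) M
  ≡⟨ det-two-rows m M rows col ⟩
    (+ 1 - - + 1) * principalMinor (F (suc (suc n))) (Vec.map suc (withZero u))
  ≡⟨ cong ((+ 1 - - + 1) *_) (principalMinor-shift (suc n) (suc m) (withZero u)) ⟩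
    (+ 1 - - + 1) * d
  ≡⟨ double d ⟩
    d + d ∎
  where
  open ≡-Reasoning
  M : Matrix (suc (suc m))
  M = restrict (F (suc (suc n))) (withZero (withZero u))
  d : ℤ
  d = principalMinor (F (suc n)) (withZero u)
  rows : ∀ b → M zero (suc b) ≡ M (suc zero) (suc b)
  rows b = begin
      F (suc (suc n)) zero (lookup (Vec.map suc (withZero u)) b)
    ≡⟨ cong (F (suc (suc n)) zero) (lookup-map b suc (withZero u)) ⟩
      F (suc (suc n)) zero (suc (lookup (withZero u) b))
    ≡⟨ F-rows-agree n (lookup (withZero u) b) ⟩
      F (suc (suc n)) (suc zero) (suc (lookup (withZero u) b))
    ≡⟨ cong (F (suc (suc n)) (suc zero)) (lookup-map b suc (withZero u)) ⟨
      F (suc (suc n)) (suc zero) (lookup (Vec.map suc (withZero u)) b) ∎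
  col : ∀ a → M (suc (suc a)) zero ≡ + 0
  col a = cong (λ x → F (suc (suc n)) x zero) (lookup-suc² u a)
  double : ∀ x → (+ 1 - - + 1) * x ≡ x + x
  double = solve-∀

total : ∀ {A : Set} → (A → ℤ) → List A → ℤ
total f l = List.foldr _+_ (+ 0) (List.map f l)

total-++ : ∀ {A : Set} (f : A → ℤ) l₁ l₂ → total f (l₁ ++ l₂) ≡ total f l₁ + total f l₂
total-++ f []       l₂ = sym (ℤP.+-identityˡ _)
total-++ f (x ∷ l₁) l₂ = cong (λ t → f x + t) (total-++ f l₁ l₂) ⟨ trans ⟩ sym (ℤP.+-assoc (f x) _ _)

total-map : ∀ {A B : Set} (f : B → ℤ) (g : A → B) l → total f (List.map g l) ≡ total (λ x → f (g x)) l
total-map f g []      = refl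
total-map f g (x ∷ l) = cong (λ t → f (g x) + t) (total-map f g l)

total-cong : ∀ {A : Set} {f g : A → ℤ} → (∀ x → f x ≡ g x) → ∀ l → total f l ≡ total g l
total-cong f≡g []      = refl
total-cong f≡g (x ∷ l) = cong₂ _+_ (f≡g x) (total-cong f≡g l)

total-double : ∀ {A : Set} (f : A → ℤ) l → total (λ x → f x + f x) l ≡ total f l + total f l
total-double f []      = refl
total-double f (x ∷ l) rewrite total-double f l = swap (f x) (total f l)
  where
  swap : ∀ a b → a + a + (b + b) ≡ a + b + (a + b)
  swap = solve-∀

total-choose : ∀ n m (f : Vec (Fin (suc n)) (suc m) → ℤ) →
  total f (choose (suc n) (suc m))
    ≡ total (λ v → f (withZero v)) (choose n m) + total (λ v → f (Vec.map suc v)) (choose n (suc m))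
total-choose n m f =
  total-++ f (List.map withZero (choose n m)) _
  ⟨ trans ⟩ cong₂ _+_ (total-map f withZero (choose n m)) (total-map f (Vec.map suc) (choose n (suc m)))

S : ℕ → ℕ → ℤ
S n m = sumPrincipalMinors n m (F n)

Z : ℕ → ℕ → ℤ
Z n m = total (λ v → principalMinor (F (suc n)) (withZero v)) (choose n m)

choose-empty : ∀ n m → n < m → choose n m ≡ []
choose-empty zero    (suc m) _ = refl
choose-empty (suc n) (suc m) (s≤s n<m)
  rewrite choose-empty n m n<m | choose-empty n (suc m) (ℕP.m<n⇒m<1+n n<m) = refl

S-empty : ∀ n m → n < m → S n m ≡ + 0
S-empty n m n<m rewrite choose-empty n m n<m = refl

S-step : ∀ n m → S (suc n) (suc m) ≡ Z n m + S n (suc m)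
S-step n m =
  total-choose n m (principalMinor (F (suc n)))
  ⟨ trans ⟩ cong (λ t → Z n m + t) (total-cong (principalMinor-shift n (suc m)) (choose n (suc m)))

Z-step : ∀ n m → Z (suc n) (suc m) ≡ (Z n m + Z n m) + S n (suc m)
Z-step n m = begin
    Z (suc n) (suc m)
  ≡⟨ total-choose n m (λ v → principalMinor (F (suc (suc n))) (withZero v)) ⟩
    total (λ u → principalMinor (F (suc (suc n))) (withZero (withZero u))) (choose n m)
      + total (λ u → principalMinor (F (suc (suc n))) (withZero (Vec.map suc u))) (choose n (suc m))
  ≡⟨ cong₂ _+_ (total-cong (minor-zero-one n m) (choose n m))
               (total-cong (minor-zero-not-one n (suc m)) (choose n (suc m))) ⟩
    total (λ u → principalMinor (F (suc n)) (withZero u) + principalMinor (F (suc n)) (withZero u)) (choose n m)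
      + S n (suc m)
  ≡⟨ cong (_+ S n (suc m)) (total-double _ (choose n m)) ⟩
    (Z n m + Z n m) + S n (suc m) ∎
  where open ≡-Reasoning

Comp : ℕ → ℕ → Set
Comp = WeakCompZeros

-- A free leading part e followed by a weak composition r with k zeros, of
-- total e + sum r = s.  Equivalently: compositions of s+1 with positive
-- first part and k zeros.
Headed : ℕ → ℕ → Set
Headed s k = Σ ℕ (λ e → Σ (List ℕ) (λ r → (e ℕ.+ sum r ≡ s) × (zeroCount r ≡ k)))

comp-≡ : ∀ {s k} l {p p' : sum l ≡ s} {q q' : zeroCount l ≡ k} →
  _≡_ {A = Comp s k} (l , p , q) (l , p' , q')
comp-≡ l {p} {p'} {q} {q'} rewrite ≡-irrelevant p p' | ≡-irrelevant q q' = refl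

headed-≡ : ∀ {s k} e r {p p' : e ℕ.+ sum r ≡ s} {q q' : zeroCount r ≡ k} →
  _≡_ {A = Headed s k} (e , r , p , q) (e , r , p' , q')
headed-≡ e r {p} {p'} {q} {q'} rewrite ≡-irrelevant p p' | ≡-irrelevant q q' = refl

comp-empty : Fin 1 ↔ Comp 0 0
comp-empty = mk↔ₛ′ (λ _ → [] , refl , refl) (λ _ → zero) unique (λ { zero → refl })
  where
  unique : ∀ c → ([] , refl , refl) ≡ c
  unique ([] , p , q)          = comp-≡ []
  unique ((zero ∷ r) , p , ())
  unique ((suc a ∷ r) , () , q)

comp-zeros : ∀ k → Comp 0 k ↔ Comp 0 (suc k)
comp-zeros k = mk↔ₛ′ prepend behead prepend-behead (λ { (r , p , q) → comp-≡ r })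
  where
  prepend : Comp 0 k → Comp 0 (suc k)
  prepend (r , p , q) = (zero ∷ r) , p , cong suc q
  behead : Comp 0 (suc k) → Comp 0 k
  behead ((zero ∷ r) , p , q)  = r , p , suc-injective q
  behead ([] , p , ())
  behead ((suc a ∷ r) , () , q)
  prepend-behead : ∀ c → prepend (behead c) ≡ c
  prepend-behead ((zero ∷ r) , p , q) = comp-≡ (zero ∷ r)
  prepend-behead ([] , p , ())
  prepend-behead ((suc a ∷ r) , () , q)

comp-positive-head : ∀ s → Headed s 0 ↔ Comp (suc s) 0
comp-positive-head s = mk↔ₛ′ glue split glue-split (λ { (a , r , p , q) → headed-≡ a r })
  where
  glue : Headed s 0 → Comp (suc s) 0
  glue (a , r , p , q) = (suc a ∷ r) , cong suc p , q
  split : Comp (suc s) 0 → Headed s 0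
  split ((suc a ∷ r) , p , q) = a , r , suc-injective p , q
  split ([] , () , q)
  split ((zero ∷ r) , p , ())
  glue-split : ∀ c → glue (split c) ≡ c
  glue-split ((suc a ∷ r) , p , q) = comp-≡ (suc a ∷ r)
  glue-split ([] , () , q)
  glue-split ((zero ∷ r) , p , ())

comp-split-head : ∀ s k → (Headed s (suc k) ⊎ Comp (suc s) k) ↔ Comp (suc s) (suc k)
comp-split-head s k = mk↔ₛ′ glue split glue-split split-glue
  where
  glue : Headed s (suc k) ⊎ Comp (suc s) k → Comp (suc s) (suc k)
  glue (inj₁ (a , r , p , q)) = (suc a ∷ r) , cong suc p , q
  glue (inj₂ (r , p , q))     = (zero ∷ r) , p , cong suc q
  split : Comp (suc s) (suc k) → Headed s (suc k) ⊎ Comp (suc s) k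
  split ((suc a ∷ r) , p , q) = inj₁ (a , r , suc-injective p , q)
  split ((zero ∷ r) , p , q)  = inj₂ (r , p , suc-injective q)
  split ([] , () , q)
  glue-split : ∀ c → glue (split c) ≡ c
  glue-split ((suc a ∷ r) , p , q) = comp-≡ (suc a ∷ r)
  glue-split ((zero ∷ r) , p , q)  = comp-≡ (zero ∷ r)
  glue-split ([] , () , q)
  split-glue : ∀ c → split (glue c) ≡ c
  split-glue (inj₁ (a , r , p , q)) = cong inj₁ (headed-≡ a r)
  split-glue (inj₂ (r , p , q))     = cong inj₂ (comp-≡ r)

headed-zero : ∀ k → Comp 0 k ↔ Headed 0 k
headed-zero k = mk↔ₛ′ (λ { (r , p , q) → 0 , r , p , q }) forget unforget (λ _ → refl)
  where
  forget : Headed 0 k → Comp 0 k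
  forget (zero , r , p , q) = r , p , q
  forget (suc e , r , () , q)
  unforget : ∀ h → (0 , forget h) ≡ h
  unforget (zero , r , p , q) = refl
  unforget (suc e , r , () , q)

headed-split : ∀ s k → (Comp (suc s) k ⊎ Headed s k) ↔ Headed (suc s) k
headed-split s k = mk↔ₛ′ glue split glue-split split-glue
  where
  glue : Comp (suc s) k ⊎ Headed s k → Headed (suc s) k
  glue (inj₁ (r , p , q))     = 0 , r , p , q
  glue (inj₂ (e , r , p , q)) = suc e , r , cong suc p , q
  split : Headed (suc s) k → Comp (suc s) k ⊎ Headed s k
  split (zero , r , p , q)  = inj₁ (r , p , q)
  split (suc e , r , p , q) = inj₂ (e , r , suc-injective p , q)
  glue-split : ∀ h → glue (split h) ≡ h
  glue-split (zero , r , p , q)  = refl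
  glue-split (suc e , r , p , q) = headed-≡ (suc e) r
  split-glue : ∀ c → split (glue c) ≡ c
  split-glue (inj₁ (r , p , q))     = refl
  split-glue (inj₂ (e , r , p , q)) = cong inj₂ (headed-≡ e r)

-- The numbers of elements of Comp and Headed, following the splittings above.
mutual
  A : ℕ → ℕ → ℕ
  A zero    k       = 1
  A (suc s) zero    = B s zero
  A (suc s) (suc k) = B s (suc k) ℕ.+ A (suc s) k

  B : ℕ → ℕ → ℕ
  B zero    k = 1
  B (suc s) k = A (suc s) k ℕ.+ B s k

comp-zero-total : ∀ k → Fin 1 ↔ Comp 0 k
comp-zero-total zero    = comp-empty
comp-zero-total (suc k) = ↔-trans (comp-zero-total k) (comp-zeros k)

mutual
  count-comp : ∀ s k → Fin (A s k) ↔ Comp s k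
  count-comp zero    k       = comp-zero-total k
  count-comp (suc s) zero    = ↔-trans (count-headed s zero) (comp-positive-head s)
  count-comp (suc s) (suc k) =
    ↔-trans +↔⊎ (↔-trans (count-headed s (suc k) ⊎-↔ count-comp (suc s) k) (comp-split-head s k))

  count-headed : ∀ s k → Fin (B s k) ↔ Headed s k
  count-headed zero    k = ↔-trans (comp-zero-total k) (headed-zero k)
  count-headed (suc s) k =
    ↔-trans +↔⊎ (↔-trans (count-comp (suc s) k ⊎-↔ count-headed s k) (headed-split s k))

-- The contribution of S (s + k) (s + 1): it is A (s + 1) (k - 1), or 0 when k = 0.
below : ℕ → ℕ → ℕ
below s zero    = 0
below s (suc k) = A (suc s) k

-- The counting form of S (n+1) (m+1) = Z n m + S n (m+1).
A-step : ∀ s k → B s k ℕ.+ below s k ≡ A (suc s) k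
A-step s zero    = ℕP.+-identityʳ _
A-step s (suc k) = refl

-- The counting form of Z (n+1) (m+1) = 2 Z n m + S n (m+1).
B-step : ∀ s k → B s k ℕ.+ B s k ℕ.+ below s k ≡ B (suc s) k
B-step s k = ℕP.+-assoc (B s k) (B s k) (below s k)
  ⟨ trans ⟩ cong (B s k ℕ.+_) (ℕP.+-comm (B s k) (below s k))
  ⟨ trans ⟩ sym (ℕP.+-assoc (B s k) (below s k) (B s k))
  ⟨ trans ⟩ cong (ℕ._+ B s k) (A-step s k)

-- In the notation n = s + k, both sides obey the same recurrences.
mutual
  S-counts : ∀ s k → S (s ℕ.+ k) s ≡ + A s k
  S-counts zero    k = refl
  S-counts (suc s) k = begin
      S (suc (s ℕ.+ k)) (suc s)
    ≡⟨ S-step (s ℕ.+ k) s ⟩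
      Z (s ℕ.+ k) s + S (s ℕ.+ k) (suc s)
    ≡⟨ cong₂ _+_ (Z-counts s k) (next-row s k) ⟩
      + (B s k ℕ.+ below s k)
    ≡⟨ cong +_ (A-step s k) ⟩
      + A (suc s) k ∎
    where open ≡-Reasoning

  Z-counts : ∀ s k → Z (s ℕ.+ k) s ≡ + B s k
  Z-counts zero    k = refl
  Z-counts (suc s) k = begin
      Z (suc (s ℕ.+ k)) (suc s)
    ≡⟨ Z-step (s ℕ.+ k) s ⟩
      (Z (s ℕ.+ k) s + Z (s ℕ.+ k) s) + S (s ℕ.+ k) (suc s)
    ≡⟨ cong₂ _+_ (cong₂ _+_ (Z-counts s k) (Z-counts s k)) (next-row s k) ⟩
      + (B s k ℕ.+ B s k ℕ.+ below s k)
    ≡⟨ cong +_ (B-step s k) ⟩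
      + B (suc s) k ∎
    where open ≡-Reasoning

  next-row : ∀ s k → S (s ℕ.+ k) (suc s) ≡ + below s k
  next-row s zero    = S-empty (s ℕ.+ 0) (suc s) (s≤s (ℕP.≤-reflexive (ℕP.+-identityʳ s)))
  next-row s (suc k) = trans (cong (λ n → S n (suc s)) (ℕP.+-suc s k)) (S-counts (suc s) k)

corollary5 : (n k : ℕ) → 1 ≤ n → k ≤ n →
    Σ ℕ (λ N → (Fin N ↔ WeakCompZeros (n ∸ k) k) × (+ N ≡ sumPrincipalMinors n (n ∸ k) (F n)))
corollary5 n k _ k≤n = A (n ∸ k) k , count-comp (n ∸ k) k , sym minors-count
  where
  minors-count : S n (n ∸ k) ≡ + A (n ∸ k) k
  minors-count = subst (λ n′ → S n′ (n ∸ k) ≡ + A (n ∸ k) k) (ℕP.m∸n+n≡m k≤n) (S-counts (n ∸ k) k)
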